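{- If $p \geq 5$ is a prime, then there is an odd prime $q$ with $q \mid L_p$.
   Context: The Lucas numbers are defined by $L_0=2$, $L_1=1$, and $L_n=L_{n-1}+L_{n-2}$ for $n>1$. -}

module Defs where

open import Data.Nat using (ℕ; zero; suc; _+_)

L : ℕ → ℕ
L zero = 2
L (suc zero) = 1
L (suc (suc n)) = L (suc n) + L n

module Submission where

-- Modulo 2 the Lucas sequence runs 0, 1, 1, 0, 1, 1, …: writing
-- a = L (n+1) and b = L n, we have L (n+3) = 2a + b ≡ b (mod 2), so the
-- parity of L n depends only on n mod 3, and L n is even exactly when
-- 3 ∣ n.  A prime p ≥ 5 is not divisible by 3, so L p is odd; it is also
-- at least 2.  Any odd number ≥ 2 has a prime factor, necessarily odd.

open import Defs
open import Data.Nat using (ℕ; _≥_; _≤_; _<_; suc; _+_; _*_; _%_; _/_; z≤n; s≤s; parity)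
open import Data.Nat.Properties using (+-assoc; +-comm; ≤-trans; m≤m+n; +-mono-≤; <⇒≢)
open import Data.Nat.DivMod using (m≡m%n+[m/n]*n; m%n<n)
open import Data.Nat.Divisibility using (_∣_; divides; m%n≡0⇒n∣m; ∣-trans; m∣m*n)
open import Data.Nat.Primality using (Prime; prime⇒irreducible)
open import Data.Nat.Primality.Factorisation using (factorise)
open import Data.Parity.Base as ℙ using (0ℙ; 1ℙ)
open import Data.Parity.Properties using (+-homo-+; *-homo-*; *-zeroʳ)
open import Data.List using ([]; _∷_)
open import Data.Nat.ListAction using (product)
open import Data.List.Relation.Unary.All using (_∷_)
open import Data.Product using (∃; _×_; _,_)
open import Data.Sum using (inj₁; inj₂)
open import Relation.Nullary using (¬_; contradiction)
open import Relation.Binary.PropositionalEquality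
  using (_≡_; refl; sym; trans; cong; subst; module ≡-Reasoning)

parity[q*2]≡0ℙ : ∀ q → parity (q * 2) ≡ 0ℙ
parity[q*2]≡0ℙ q = trans (*-homo-* q 2) (*-zeroʳ (parity q))

parity≡1ℙ⇒odd : ∀ {n} → parity n ≡ 1ℙ → ¬ (2 ∣ n)
parity≡1ℙ⇒odd odd (divides q refl) with trans (sym odd) (parity[q*2]≡0ℙ q)
... | ()

parity-cancel : ∀ a b → (a ℙ.+ b) ℙ.+ a ≡ b
parity-cancel 0ℙ 0ℙ = refl
parity-cancel 0ℙ 1ℙ = refl
parity-cancel 1ℙ 0ℙ = refl
parity-cancel 1ℙ 1ℙ = refl

lucas-parity-period : ∀ n → parity (L (3 + n)) ≡ parity (L n)
lucas-parity-period n = begin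
  parity ((L (suc n) + L n) + L (suc n))
    ≡⟨ +-homo-+ (L (suc n) + L n) (L (suc n)) ⟩
  parity (L (suc n) + L n) ℙ.+ parity (L (suc n))
    ≡⟨ cong (ℙ._+ parity (L (suc n))) (+-homo-+ (L (suc n)) (L n)) ⟩
  (parity (L (suc n)) ℙ.+ parity (L n)) ℙ.+ parity (L (suc n))
    ≡⟨ parity-cancel (parity (L (suc n))) (parity (L n)) ⟩
  parity (L n) ∎
  where open ≡-Reasoning

lucas-parity-residue : ∀ r k → parity (L (r + k * 3)) ≡ parity (L r)
lucas-parity-residue r 0 = cong (λ m → parity (L m)) (+-comm r 0)
lucas-parity-residue r (suc k) = begin
  parity (L (r + (3 + k * 3))) ≡⟨ cong (λ m → parity (L m)) (shift (k * 3)) ⟩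
  parity (L (3 + (r + k * 3))) ≡⟨ lucas-parity-period (r + k * 3) ⟩
  parity (L (r + k * 3))       ≡⟨ lucas-parity-residue r k ⟩
  parity (L r)                 ∎
  where
  open ≡-Reasoning
  shift : ∀ m → r + (3 + m) ≡ 3 + (r + m)
  shift m = trans (sym (+-assoc r 3 m)) (trans (cong (_+ m) (+-comm r 3)) (+-assoc 3 r m))

-- If 3 does not divide n, then L n is odd (its residue class gives L 1 or L 2).
lucas-odd : ∀ n → ¬ (3 ∣ n) → ¬ (2 ∣ L n)
lucas-odd n 3∤n = parity≡1ℙ⇒odd (trans (cong (λ m → parity (L m)) n≡r+3k) odd-residue)
  where
  n≡r+3k : n ≡ n % 3 + (n / 3) * 3
  n≡r+3k = m≡m%n+[m/n]*n n 3
  residue : ∀ r → n % 3 ≡ r → r < 3 → parity (L (r + (n / 3) * 3)) ≡ 1ℙ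
  residue 0 n%3≡0 _ = contradiction (m%n≡0⇒n∣m n 3 n%3≡0) 3∤n
  residue 1 _ _ = lucas-parity-residue 1 (n / 3)
  residue 2 _ _ = lucas-parity-residue 2 (n / 3)
  residue (suc (suc (suc _))) _ (s≤s (s≤s (s≤s ())))
  odd-residue : parity (L (n % 3 + (n / 3) * 3)) ≡ 1ℙ
  odd-residue = residue (n % 3) refl (m%n<n n 3)

lucas-positive : ∀ n → 1 ≤ L n
lucas-positive 0 = s≤s z≤n
lucas-positive 1 = s≤s z≤n
lucas-positive (suc (suc n)) = ≤-trans (lucas-positive (suc n)) (m≤m+n (L (suc n)) (L n))

lucas-≥2 : ∀ n → 2 ≤ L (suc (suc n))
lucas-≥2 n = +-mono-≤ (lucas-positive (suc n)) (lucas-positive n)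

prime-divisor : ∀ n → 2 ≤ n → ∃ λ q → Prime q × q ∣ n
prime-divisor n@(suc (suc _)) _ with factorise n
... | record { factors = q ∷ qs ; isFactorisation = n≡Π ; factorsPrime = q-prime ∷ _ } =
  q , q-prime , subst (q ∣_) (sym n≡Π) (m∣m*n (product qs))
... | record { factors = [] ; isFactorisation = () }
prime-divisor 1 (s≤s ())

odd-prime-divisor : ∀ n → 2 ≤ n → ¬ (2 ∣ n) → ∃ λ q → Prime q × ¬ (2 ∣ q) × q ∣ n
odd-prime-divisor n n≥2 2∤n with prime-divisor n n≥2
... | q , q-prime , q∣n = q , q-prime , (λ 2∣q → 2∤n (∣-trans 2∣q q∣n)) , q∣n

prime≥5⇒3∤ : ∀ p → Prime p → p ≥ 5 → ¬ (3 ∣ p)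
prime≥5⇒3∤ p p-prime p≥5 3∣p with prime⇒irreducible p-prime 3∣p
... | inj₁ ()
... | inj₂ 3≡p = <⇒≢ (≤-trans (s≤s (s≤s (s≤s (s≤s z≤n)))) p≥5) 3≡p

lemma7 : (p : ℕ) → Prime p → p ≥ 5 → ∃ λ q → Prime q × ¬ (2 ∣ q) × q ∣ L p
lemma7 p@(suc (suc m)) p-prime p≥5 =
  odd-prime-divisor (L p) (lucas-≥2 m) (lucas-odd p (prime≥5⇒3∤ p p-prime p≥5))
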